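{- Let $G$ be a Helly graph and $S$ a nonempty vertex subset of weak diameter at most two. Then for any vertex $v\notin S$ there exists a vertex $g_S(v)\in N^{dist(v,S)-1}[v]\cap\bigcap\{N(x): x\in Pr(v,S)\}$.
   Context: Graphs are finite, connected, undirected and unweighted, with shortest-path distance $dist$. $N^r[v]=\{u: dist(u,v)\le r\}$, $N(x)$ is the open neighbourhood of $x$. A graph is Helly if every family of pairwise intersecting balls has a nonempty common intersection. The weak diameter of $S$ is $\max_{x,y\in S}dist(x,y)$. $dist(v,S)=\min_{s\in S}dist(v,s)$ and the metric projection is $Pr(v,S)=\{s\in S: dist(v,s)=dist(v,S)\}$. -}

module Defs where

open import Data.Nat using (ℕ; zero; suc; _≤_)
open import Data.Fin using (Fin)
open import Data.Fin.Subset using (Subset; _∈_; _∉_)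
open import Data.Product using (Σ; ∃; _×_; _,_)
open import Relation.Nullary using (¬_; Dec)

record Graph : Set₁ where
  field
    n       : ℕ
    Adj     : Fin n → Fin n → Set
    adj?    : ∀ u v → Dec (Adj u v)
    sym     : ∀ {u v} → Adj u v → Adj v u
    irrefl  : ∀ {u} → ¬ Adj u u

module _ (G : Graph) where
  open Graph G

  data Walk : Fin n → Fin n → ℕ → Set where
    here : ∀ {u} → Walk u u zero
    step : ∀ {u w v k} → Adj u w → Walk w v k → Walk u v (suc k)

  Connected : Set
  Connected = ∀ u v → ∃ λ k → Walk u v k

  IsDist : Fin n → Fin n → ℕ → Set
  IsDist u v d = Walk u v d × (∀ k → Walk u v k → d ≤ k)

  InBall : Fin n → ℕ → Fin n → Set
  InBall v r u = ∃ λ d → IsDist u v d × d ≤ r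

  Helly : Set₁
  Helly = (I : Set) (c : I → Fin n) (r : I → ℕ) →
          (∀ i j → ∃ λ x → InBall (c i) (r i) x × InBall (c j) (r j) x) →
          ∃ λ x → ∀ i → InBall (c i) (r i) x

  WeakDiam≤ : Subset n → ℕ → Set
  WeakDiam≤ S k = ∀ x y → x ∈ S → y ∈ S → ∃ λ d → IsDist x y d × d ≤ k

  NonEmpty : Subset n → Set
  NonEmpty S = ∃ λ s → s ∈ S

  IsDistSet : Fin n → Subset n → ℕ → Set
  IsDistSet v S d = (∃ λ s → s ∈ S × IsDist v s d)
                  × (∀ s e → s ∈ S → IsDist v s e → d ≤ e)

  -- s ∈ Pr(v,S), given that dist(v,S) = d
  InProj : Fin n → Subset n → ℕ → Fin n → Set
  InProj v S d s = s ∈ S × IsDist v s d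

-- Consider the family of balls N^{d-1}[v] and N^1[x], x ∈ Pr(v,S).
-- They pairwise intersect: two balls N^r[a], N^s[b] meet as soon as there is
-- an a-b walk of length ≤ r + s (cut the walk after r steps), and
--   dist(v,x) = d ≤ (d-1) + 1,   dist(x,y) ≤ 2 = 1 + 1   for x, y ∈ Pr(v,S).
-- By the Helly property some g lies in all of them.  Being within distance 1
-- of x, g is either adjacent to x or equal to x; the latter is impossible,
-- since x is at distance d from v while g is at distance ≤ d-1 (and x ≠ v).

module Submission where

open import Defs
open import Data.Nat using (ℕ; zero; suc; _+_; _∸_; _≤_; _<_; z≤n; s≤s)
open import Data.Nat.Properties
  using (≤-refl; ≤-trans; <⇒≤; ≮⇒≥; m≤n+m∸n; anyUpTo?; <-irrefl)
open import Data.Nat.Induction using (<-wellFounded)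
open import Induction.WellFounded using (Acc; acc)
open import Data.Fin using (Fin)
open import Data.Fin.Subset using (Subset; _∈_; _∉_)
open import Data.Fin.Properties using (any?; _≟_)
open import Data.Product using (Σ; ∃; _×_; _,_; proj₁; proj₂)
open import Data.Sum using (_⊎_; inj₁; inj₂)
open import Data.Maybe using (Maybe; nothing; just)
open import Data.Empty using (⊥-elim)
open import Relation.Nullary using (Dec; yes; no)
open import Relation.Nullary.Decidable using (map′; _×-dec_)
open import Relation.Binary.PropositionalEquality using (_≡_; refl; subst)

module WalkMetric (G : Graph) where
  open Graph G

  _▷_ : ∀ {u w v k} → Walk G u w k → Adj w v → Walk G u v (suc k)
  here     ▷ a = step a here
  step b p ▷ a = step b (p ▷ a)

  reverse : ∀ {u v k} → Walk G u v k → Walk G v u k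
  reverse here       = here
  reverse (step a p) = reverse p ▷ sym a

  walk? : ∀ u v k → Dec (Walk G u v k)
  walk? u v zero    = map′ (λ { refl → here }) (λ { here → refl }) (u ≟ v)
  walk? u v (suc k) =
    map′ (λ { (w , a , p) → step a p }) (λ { (step a p) → _ , a , p })
         (any? λ w → adj? u w ×-dec walk? w v k)

  shortest : ∀ {u v k} → Walk G u v k → ∃ λ d → IsDist G u v d × d ≤ k
  shortest {u} {v} = go (<-wellFounded _)
    where
    go : ∀ {k} → Acc _<_ k → Walk G u v k → ∃ λ d → IsDist G u v d × d ≤ k
    go {k} (acc shorter) p with anyUpTo? (walk? u v) k
    ... | yes (j , j<k , q) with go (shorter j<k) q
    ...   | d , isDist , d≤j = d , isDist , ≤-trans d≤j (<⇒≤ j<k)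
    go {k} (acc shorter) p | no none =
      k , (p , λ j q → ≮⇒≥ λ j<k → none (j , j<k , q)) , ≤-refl

  Reach : Fin n → ℕ → Fin n → Set
  Reach c r u = ∃ λ k → Walk G u c k × k ≤ r

  ball⇒reach : ∀ {c r u} → InBall G c r u → Reach c r u
  ball⇒reach (d , (p , _) , d≤r) = d , p , d≤r

  reach⇒ball : ∀ {c r u} → Reach c r u → InBall G c r u
  reach⇒ball (k , p , k≤r) with shortest p
  ... | d , isDist , d≤k = d , isDist , ≤-trans d≤k k≤r

  helly-reach : Helly G → (I : Set) (c : I → Fin n) (r : I → ℕ) →
                (∀ i j → ∃ λ x → Reach (c i) (r i) x × Reach (c j) (r j) x) →
                ∃ λ x → ∀ i → Reach (c i) (r i) x
  helly-reach helly I c r meet with helly I c r meetBalls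
    where
    meetBalls : ∀ i j → ∃ λ x → InBall G (c i) (r i) x × InBall G (c j) (r j) x
    meetBalls i j with meet i j
    ... | x , ri , rj = x , reach⇒ball ri , reach⇒ball rj
  ... | x , inAll = x , λ i → ball⇒reach (inAll i)

  reach-step : ∀ {u w r p} → Adj u w → Reach w r p → Reach u (suc r) p
  reach-step a (k , q , k≤r) = suc k , q ▷ sym a , s≤s k≤r

  -- Balls N^r[x] and N^s[y] meet if some x-y walk has length ≤ r + s:
  -- the vertex r steps along the walk lies in both.
  balls-meet : ∀ {x y k} r s → Walk G x y k → k ≤ r + s →
               ∃ λ p → Reach x r p × Reach y s p
  balls-meet {x} zero s p k≤s = x , (0 , here , z≤n) , (_ , p , k≤s)
  balls-meet {x} (suc r) s here _ = x , (0 , here , z≤n) , (0 , here , z≤n)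
  balls-meet (suc r) s (step a p) (s≤s k≤r+s) with balls-meet r s p k≤r+s
  ... | q , inX , inY = q , reach-step a inX , inY

  reach-one : ∀ {c u} → Reach c 1 u → u ≡ c ⊎ Adj u c
  reach-one (0 , here , _)        = inj₁ refl
  reach-one (1 , step a here , _) = inj₂ a
  reach-one (suc (suc _) , _ , s≤s ())

  dist-outside-smaller-ball : ∀ {v x d} → IsDist G v x d →
                              Reach v (d ∸ 1) x → x ≡ v
  dist-outside-smaller-ball {d = zero} (here , _) _ = refl
  dist-outside-smaller-ball {d = suc e} (_ , minimal) (k , p , k≤e) =
    ⊥-elim (<-irrefl refl (≤-trans (minimal k (reverse p)) k≤e))

module ProjectionBalls (G : Graph) (S : Subset (Graph.n G)) (v : Fin (Graph.n G))
                       (d : ℕ) where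
  open Graph G
  open WalkMetric G

  -- Index set of the family: nothing for the ball around v, just x for x ∈ Pr(v,S).
  Index : Set
  Index = Maybe (Σ (Fin n) λ x → InProj G v S d x)

  centre : Index → Fin n
  centre nothing        = v
  centre (just (x , _)) = x

  radius : Index → ℕ
  radius nothing  = d ∸ 1
  radius (just _) = 1

  -- dist(x,v) = d ≤ 1 + (d-1), and dist(x,y) ≤ 2 = 1 + 1 inside S.
  pairwise-meet : WeakDiam≤ G S 2 → ∀ i j →
                  ∃ λ p → Reach (centre i) (radius i) p × Reach (centre j) (radius j) p
  pairwise-meet _ nothing nothing = balls-meet (d ∸ 1) (d ∸ 1) here z≤n
  pairwise-meet _ (just (x , _ , vx , _)) nothing =
    balls-meet 1 (d ∸ 1) (reverse vx) (m≤n+m∸n d 1)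
  pairwise-meet _ nothing (just (x , _ , vx , _))
    with balls-meet 1 (d ∸ 1) (reverse vx) (m≤n+m∸n d 1)
  ... | p , inX , inV = p , inV , inX
  pairwise-meet diam (just (x , x∈S , _)) (just (y , y∈S , _))
    with diam x y x∈S y∈S
  ... | e , (xy , _) , e≤2 = balls-meet 1 1 xy e≤2

lemma10 : (G : Graph) → Connected G → Helly G →
          (S : Subset (Graph.n G)) → NonEmpty G S → WeakDiam≤ G S 2 →
          (v : Fin (Graph.n G)) → v ∉ S →
          (d : ℕ) → IsDistSet G v S d →
          ∃ λ g → InBall G v (d ∸ 1) g ×
                  (∀ x → InProj G v S d x → Graph.Adj G g x)
lemma10 G _ helly S _ diam v v∉S d _ = g , reach⇒ball nearV , adjacent
  where
  open Graph G using (Adj)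
  open WalkMetric G
  open ProjectionBalls G S v d

  common : ∃ λ g → ∀ i → Reach (centre i) (radius i) g
  common = helly-reach helly Index centre radius (pairwise-meet diam)

  g : Fin (Graph.n G)
  g = proj₁ common

  nearV : Reach v (d ∸ 1) g
  nearV = proj₂ common nothing

  -- g ∈ N^1[x] and g ≠ x, because x ∉ N^{d-1}[v] ∋ g (as x ≠ v).
  adjacent : ∀ x → InProj G v S d x → Adj g x
  adjacent x px@(x∈S , vx) with reach-one (proj₂ common (just (x , px)))
  ... | inj₂ a    = a
  ... | inj₁ g≡x = ⊥-elim (v∉S (subst (_∈ S) x≡v x∈S))
    where
    x≡v : x ≡ v
    x≡v = dist-outside-smaller-ball vx (subst (Reach v (d ∸ 1)) g≡x nearV)
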